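{- Let $M$ be a multiline queue, and let $r$ and $i$ be such that $L_M(r,i)>r$ and $L_M(r+1,i)\neq L_M(r,i)$. Then either $L_M(r,i-1)=0$ or $L_M(r,i-1)\ge L_M(r,i)$.
   Context: Fix $n$. For a partition $\lambda$ with $L=\lambda_1$, $n>\ell(\lambda)$, a multiline queue (MLQ) of shape $\lambda$ is a tuple $M=(B_1,\dots,B_L)$ of subsets of $[n]$ with $|B_r|=\lambda'_r$, pictured as an array with rows $1..L$ bottom to top and columns $1..n$ left to right, numbered periodically modulo $n$ (so column $0$ is column $n$), with a ball at $(r,j)$ iff $j\in B_r$. FM labelling: for $r=L,\dots,2$: unlabelled balls of row $r$ get label $r$; then balls of row $r$ in order of decreasing label (left to right among equals) are each paired with the first not-yet-paired ball of row $r-1$ weakly to the right (cyclically wrapping from column $n$ to column 1), which gets the same label. Remaining balls of row 1 get label 1. $L_M(s,j)$ is the label of the ball at site $(s,j)$, or 0 if there is no ball. -}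

module Defs where

open import Data.Nat using (ℕ; zero; suc; _+_; _∸_; _≤_; _<_; _≤?_; _≡ᵇ_; _≤ᵇ_)
open import Data.Bool using (Bool; true; false; if_then_else_; _∧_)
open import Data.List using (List; []; _∷_; length; filter; upTo; downFrom; map; concatMap; drop; take; _++_; foldl)
open import Data.List.Relation.Unary.All using (All)
open import Data.List.Relation.Unary.Linked using (Linked)
open import Data.Maybe using (Maybe; just; nothing)
open import Data.Product using (_×_; _,_)
open import Data.Vec using (Vec; toList; lookup)
open import Data.Fin using (Fin; toℕ)
open import Data.Fin.Subset using (Subset; ∣_∣)
open import Relation.Binary.PropositionalEquality using (_≡_)
open import Relation.Nullary.Decidable using (T?)

IsPartition : List ℕ → Set
IsPartition p = All (1 ≤_) p × Linked (λ a b → b ≤ a) p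

largest : List ℕ → ℕ
largest []      = 0
largest (x ∷ _) = x

conj : List ℕ → ℕ → ℕ
conj p r = length (filter (r ≤?_) p)

-- Multiline queues
-- An MLQ of shape p on n columns: a tuple (B_1,…,B_L), L = largest p,
-- stored as a vector whose entry at index r-1 (Fin L) is B_r ⊆ [n].
-- Column c ∈ {1..n} of the paper corresponds to index c-1 of Fin n.

MLQ : ℕ → List ℕ → Set
MLQ n p = Vec (Subset n) (largest p)

IsMLQ : (n : ℕ) (p : List ℕ) → MLQ n p → Set
IsMLQ n p B = (r : Fin (largest p)) → ∣ lookup B r ∣ ≡ conj p (suc (toℕ r))

-- FM labelling.  Internally columns are 0-based t ∈ {0..n-1}
-- (t = paper column t+1); rows are 1-based.

private
  atB : List Bool → ℕ → Bool
  atB []       _       = false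
  atB (b ∷ _)  zero    = b
  atB (_ ∷ bs) (suc t) = atB bs t

  rowAt : ∀ {A : Set} {L} → Vec A L → ℕ → Maybe A
  rowAt {L = L} v r = go (toList v) r
    where
    go : ∀ {A : Set} → List A → ℕ → Maybe A
    go []       _             = nothing
    go (x ∷ _)  (suc zero)    = just x
    go (_ ∷ xs) (suc (suc k)) = go xs (suc k)
    go _        zero          = nothing

occ : ∀ {n p} → MLQ n p → ℕ → ℕ → Bool
occ {n} {p} B r t with rowAt B r
... | just S  = atB (toList S) t
... | nothing = false

firstAvail : (ℕ → Bool) → List ℕ → Maybe ℕ
firstAvail av []       = nothing
firstAvail av (t ∷ ts) = if av t then just t else firstAvail av ts

cyclicFrom : ℕ → ℕ → List ℕ
cyclicFrom n t = drop t (upTo n) ++ take t (upTo n)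

updB : (ℕ → Bool) → ℕ → Bool → ℕ → Bool
updB f t v x = if x ≡ᵇ t then v else f x

updN : (ℕ → ℕ) → ℕ → ℕ → ℕ → ℕ
updN f t v x = if x ≡ᵇ t then v else f x

processOrder : (n L : ℕ) → (ℕ → ℕ) → List ℕ
processOrder n L above =
  concatMap (λ ℓ → filter (λ t → T? (above t ≡ᵇ ℓ)) (upTo n))
            (map suc (downFrom L))

-- one pairing step: labels of the full upper row, occupancy of the lower row
-- ↦ partial labels of the lower row (0 = empty or not yet labelled)
pairStep : (n L : ℕ) → (ℕ → ℕ) → (ℕ → Bool) → ℕ → ℕ
pairStep n L above below = Data.Product.proj₂ (foldl step (below , (λ _ → 0)) (processOrder n L above))
  where
  step : (ℕ → Bool) × (ℕ → ℕ) → ℕ → (ℕ → Bool) × (ℕ → ℕ)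
  step (av , part) t with firstAvail av (cyclicFrom n t)
  ... | just t' = updB av t' false , updN part t' (above t)
  ... | nothing = av , part

fill : ℕ → (ℕ → Bool) → (ℕ → ℕ) → ℕ → ℕ
fill r below part t = if below t then (if part t ≡ᵇ 0 then r else part t) else 0

-- labels of row L ∸ k (k = 0 … L-1), internal columns
rowLabels : ∀ {n p} → MLQ n p → ℕ → ℕ → ℕ
rowLabels {n} {p} B zero    t = if occ {n} {p} B (largest p) t then largest p else 0
rowLabels {n} {p} B (suc k) t =
  let r = largest p ∸ suc k in
  fill r (occ {n} {p} B r) (pairStep n (largest p) (rowLabels {n} {p} B k) (occ {n} {p} B r)) t

-- L_M(s, j): label of the ball at site (s, j), 0 if no ball.
-- Rows s ∈ {1..L}; columns j ∈ {0..n}, with column 0 = column n.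
LM : (n : ℕ) (p : List ℕ) → MLQ n p → ℕ → ℕ → ℕ
LM n p B s j =
  if (1 ≤ᵇ s) ∧ (s ≤ᵇ largest p) then rowLabels {n} {p} B (largest p ∸ s) (colIdx j) else 0
  where
  colIdx : ℕ → ℕ
  colIdx zero    = n ∸ 1
  colIdx (suc c) = c

module Submission where

-- If the ball at (r, i) has label ℓ > r, it was paired with a ball of label ℓ in row r + 1,
-- and since L(r + 1, i) ≠ ℓ that ball sits in another column t.  The cyclic search from t
-- reached i only after passing column i - 1, which was therefore empty or already paired.
-- Balls of row r + 1 are processed by decreasing label, so every ball paired earlier
-- carries a label ≥ ℓ.

open import Data.Bool using (Bool; true; false; if_then_else_; T)
open import Data.Empty using (⊥-elim)
open import Data.List using (List; []; _∷_; _++_; length; foldl; drop; take; applyUpTo; upTo; last; head; filter; concatMap; map; downFrom)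
open import Data.List.Properties using (foldl-cong; foldl-++)
open import Data.List.Relation.Unary.All as All using (All; []; _∷_)
import Data.List.Relation.Unary.All.Properties as AllP
open import Data.List.Relation.Unary.Linked using (Linked; _∷_)
open import Data.List.Relation.Unary.Linked.Properties using (++⁺; applyUpTo⁺₂)
open import Data.Maybe using (just; nothing)
open import Data.Maybe.Relation.Binary.Connected using (Connected; just; just-nothing)
open import Data.Nat using (ℕ; zero; suc; _+_; _∸_; _≤_; _<_; _≥_; _>_; _≡ᵇ_; _≤ᵇ_; z≤n; s≤s)
open import Data.Nat.Properties
open import Data.Product using (Σ; _×_; _,_; proj₁; proj₂; map₂)
open import Data.Sum using (_⊎_; inj₁; inj₂)
open import Relation.Binary.PropositionalEquality using (_≡_; _≢_; refl; sym; trans; cong; subst; ≢-sym)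
open import Relation.Nullary using (yes; no; contradiction)
open import Relation.Nullary.Decidable using (T?)

open import Defs

cycPred : ℕ → ℕ → ℕ
cycPred n zero    = n ∸ 1
cycPred n (suc x) = x

CyclicSuccessor : ℕ → ℕ → ℕ → Set
CyclicSuccessor n x y = cycPred n y ≡ x

drop-applyUpTo : ∀ {A : Set} (f : ℕ → A) t m → drop t (applyUpTo f (t + m)) ≡ applyUpTo (λ i → f (t + i)) m
drop-applyUpTo f zero    m = refl
drop-applyUpTo f (suc t) m = drop-applyUpTo (λ i → f (suc i)) t m

take-applyUpTo : ∀ {A : Set} (f : ℕ → A) t m → take t (applyUpTo f (t + m)) ≡ applyUpTo f t
take-applyUpTo f zero    m = refl
take-applyUpTo f (suc t) m = cong (f 0 ∷_) (take-applyUpTo (λ i → f (suc i)) t m)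

last-applyUpTo : ∀ {A : Set} (f : ℕ → A) m → last (applyUpTo f (suc m)) ≡ just (f m)
last-applyUpTo f zero          = refl
last-applyUpTo f (suc zero)    = refl
last-applyUpTo f (suc (suc m)) = last-applyUpTo (λ i → f (suc i)) (suc m)

cyclicFrom-split : ∀ t k → cyclicFrom (t + suc k) t ≡ applyUpTo (t +_) (suc k) ++ upTo t
cyclicFrom-split t k rewrite drop-applyUpTo (λ i → i) t (suc k) | take-applyUpTo (λ i → i) t (suc k) = refl

cyclicOrder-wraps : ∀ t k →
  Connected (CyclicSuccessor (t + suc k)) (last (applyUpTo (t +_) (suc k))) (head (upTo t))
cyclicOrder-wraps t k rewrite last-applyUpTo (t +_) k with t
... | zero   = just-nothing
... | suc t′ = just (+-suc t′ k)

cyclicOrder-linked : ∀ t k → Linked (CyclicSuccessor (t + suc k)) (applyUpTo (t +_) (suc k) ++ upTo t)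
cyclicOrder-linked t k =
  ++⁺ (applyUpTo⁺₂ (t +_) (suc k) successive) (cyclicOrder-wraps t k) (applyUpTo⁺₂ (λ i → i) t (λ _ → refl))
  where
  successive : ∀ i → cycPred (t + suc k) (t + suc i) ≡ t + i
  successive i rewrite +-suc t i = refl

firstAvail-available : ∀ av xs {t′} → firstAvail av xs ≡ just t′ → av t′ ≡ true
firstAvail-available av (x ∷ xs) eq with av x in avx
firstAvail-available av (x ∷ xs) refl | true  = avx
firstAvail-available av (x ∷ xs) eq   | false = firstAvail-available av xs eq

firstAvail-skipped : ∀ (pred : ℕ → ℕ) av x xs {t′} → Linked (λ u v → pred v ≡ u) (x ∷ xs) →
  firstAvail av (x ∷ xs) ≡ just t′ → t′ ≢ x → av (pred t′) ≡ false
firstAvail-skipped pred av x xs {t′} chain eq t′≢x with av x in avx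
firstAvail-skipped pred av x xs {t′} chain        refl t′≢x | true = ⊥-elim (t′≢x refl)
firstAvail-skipped pred av x (y ∷ xs) {t′} (pred-y ∷ chain) eq t′≢x | false with y ≟ t′
... | yes refl = trans (cong av pred-y) avx
... | no  y≢t′ = firstAvail-skipped pred av y xs chain eq (≢-sym y≢t′)

firstAvail-cyclic-skipped : ∀ {n} av {t t′} → t < n → firstAvail av (cyclicFrom n t) ≡ just t′ → t′ ≢ t →
  av (cycPred n t′) ≡ false
firstAvail-cyclic-skipped {n} av {t} {t′} t<n =
  subst (λ m → firstAvail av (cyclicFrom m t) ≡ just t′ → t′ ≢ t → av (cycPred m t′) ≡ false)
        (trans (+-suc t _) (m+[n∸m]≡n t<n)) (skipped (n ∸ suc t))
  where
  skipped : ∀ k → firstAvail av (cyclicFrom (t + suc k) t) ≡ just t′ → t′ ≢ t → av (cycPred (t + suc k) t′) ≡ false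
  skipped k eq t′≢t rewrite cyclicFrom-split t k =
    firstAvail-skipped (cycPred (t + suc k)) av (t + 0) _ (cyclicOrder-linked t k) eq
                       (λ t′≡t+0 → t′≢t (trans t′≡t+0 (+-identityʳ t)))

-- The lower-row balls still free to be paired, and the labels assigned so far (0: none).
Stage : Set
Stage = (ℕ → Bool) × (ℕ → ℕ)

pairingStep : ℕ → (ℕ → ℕ) → Stage → ℕ → Stage
pairingStep n above (free , label) t with firstAvail free (cyclicFrom n t)
... | just t′ = updB free t′ false , updN label t′ (above t)
... | nothing = free , label

-- The step function of pairStep is local to its definition; unification recovers it.
pairStep-isFold : ∀ n L above below → Σ (Stage → ℕ → Stage) λ step →
  pairStep n L above below ≡ proj₂ (foldl step (below , λ _ → 0) (processOrder n L above))
pairStep-isFold n L above below = _ , refl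

pairStep-step≗pairingStep : ∀ n L above below free label t →
  proj₁ (pairStep-isFold n L above below) (free , label) t ≡ pairingStep n above (free , label) t
pairStep-step≗pairingStep n L above below free label t with firstAvail free (cyclicFrom n t)
... | just t′ = refl
... | nothing = refl

pairStep≡foldl-pairingStep : ∀ n L above below →
  pairStep n L above below ≡ proj₂ (foldl (pairingStep n above) (below , λ _ → 0) (processOrder n L above))
pairStep≡foldl-pairingStep n L above below =
  trans (proj₂ (pairStep-isFold n L above below))
        (cong proj₂ (foldl-cong (λ { (free , label) t → pairStep-step≗pairingStep n L above below free label t })
                                (below , λ _ → 0) (processOrder n L above)))

update-same : ∀ {A : Set} t (v w : A) → (if t ≡ᵇ t then v else w) ≡ v
update-same zero    v w = refl
update-same (suc t) v w = update-same t v w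

update-other : ∀ {A : Set} {x t} (v w : A) → x ≢ t → (if x ≡ᵇ t then v else w) ≡ w
update-other {x = x} {t} v w x≢t with x ≡ᵇ t | ≡ᵇ⇒≡ x t
... | true  | x≡t = ⊥-elim (x≢t (x≡t _))
... | false | _   = refl

LeftNeighbourDominates : ℕ → (above : ℕ → ℕ) (below : ℕ → Bool) (label : ℕ → ℕ) → Set
LeftNeighbourDominates n above below label = ∀ x → 0 < label x → above x ≢ label x →
  below (cycPred n x) ≡ false ⊎ (0 < label (cycPred n x) × label x ≤ label (cycPred n x))

module PairingInvariant (n : ℕ) (above : ℕ → ℕ) (below : ℕ → Bool) where

  record Invariant (m : ℕ) (s : Stage) : Set where
    field
      free⇒unlabelled : ∀ x → proj₁ s x ≡ true → proj₂ s x ≡ 0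
      paired⇒labelled≥ : ∀ x → below x ≡ true → proj₁ s x ≡ false → 0 < proj₂ s x × m ≤ proj₂ s x
      leftNeighbour : LeftNeighbourDominates n above below (proj₂ s)

  module _ {m t free label t′} (t<n : t < n) (above-t : above t ≡ m) (m>0 : 0 < m)
           (inv : Invariant m (free , label)) (found : firstAvail free (cyclicFrom n t) ≡ just t′) where
    open Invariant inv

    free′ : ℕ → Bool
    free′ = updB free t′ false
    label′ : ℕ → ℕ
    label′ = updN label t′ (above t)

    t′-free : free t′ ≡ true
    t′-free = firstAvail-available free (cyclicFrom n t) found

    label′-elsewhere : ∀ {x} → x ≢ t′ → label′ x ≡ label x
    label′-elsewhere = update-other (above t) _

    free′-elsewhere : ∀ {x} → x ≢ t′ → free′ x ≡ free x
    free′-elsewhere = update-other false _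

    free′⇒unlabelled : ∀ x → free′ x ≡ true → label′ x ≡ 0
    free′⇒unlabelled x free′-x with x ≟ t′
    ... | no  x≢t′ rewrite label′-elsewhere x≢t′ | free′-elsewhere x≢t′ = free⇒unlabelled x free′-x
    ... | yes refl with trans (sym (update-same x false (free x))) free′-x
    ...   | ()

    paired′⇒labelled≥ : ∀ x → below x ≡ true → free′ x ≡ false → 0 < label′ x × m ≤ label′ x
    paired′⇒labelled≥ x below-x free′-x with x ≟ t′
    ... | yes refl rewrite update-same x (above t) (label x) | above-t = m>0 , ≤-refl
    ... | no  x≢t′ rewrite label′-elsewhere x≢t′ | free′-elsewhere x≢t′ = paired⇒labelled≥ x below-x free′-x

    labelled⇒≢t′ : ∀ {y} → 0 < label y → y ≢ t′
    labelled⇒≢t′ y>0 refl = <⇒≢ y>0 (sym (free⇒unlabelled t′ t′-free))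

    taken⇒≢t′ : ∀ {y} → free y ≡ false → y ≢ t′
    taken⇒≢t′ y-taken refl with trans (sym t′-free) y-taken
    ... | ()

    left-of-t′-taken : above t′ ≢ above t → free (cycPred n t′) ≡ false
    left-of-t′-taken above≢ = firstAvail-cyclic-skipped free t<n found (λ t′≡t → above≢ (cong above t′≡t))

    leftNeighbour′ : LeftNeighbourDominates n above below label′
    leftNeighbour′ x label′-x>0 above≢label′ with x ≟ t′
    leftNeighbour′ x label′-x>0 above≢label′ | no x≢t′
      rewrite label′-elsewhere x≢t′ with leftNeighbour x label′-x>0 above≢label′
    ... | inj₁ empty = inj₁ empty
    ... | inj₂ (left>0 , x≤left) rewrite label′-elsewhere (labelled⇒≢t′ left>0) = inj₂ (left>0 , x≤left)
    leftNeighbour′ x label′-x>0 above≢label′ | yes refl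
      rewrite update-same x (above t) (label x) with below (cycPred n x) in below-left
    ... | false = inj₁ refl
    ... | true with left-of-t′-taken above≢label′
    ... | left-taken rewrite label′-elsewhere (taken⇒≢t′ left-taken) | above-t =
      inj₂ (paired⇒labelled≥ (cycPred n x) below-left left-taken)

  pairingStep-preserves : ∀ {m t} s → t < n → above t ≡ m → 0 < m → Invariant m s →
                          Invariant m (pairingStep n above s t)
  pairingStep-preserves {t = t} (free , label) t<n above-t m>0 inv with firstAvail free (cyclicFrom n t) in found
  ... | nothing = inv
  ... | just t′ = record
    { free⇒unlabelled = free′⇒unlabelled t<n above-t m>0 inv found
    ; paired⇒labelled≥ = paired′⇒labelled≥ t<n above-t m>0 inv found
    ; leftNeighbour    = leftNeighbour′ t<n above-t m>0 inv found
    }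

  labelGroup : ℕ → List ℕ
  labelGroup ℓ = filter (λ t → T? (above t ≡ᵇ ℓ)) (upTo n)

  labelGroup-members : ∀ ℓ → All (λ t → t < n × above t ≡ ℓ) (labelGroup ℓ)
  labelGroup-members ℓ = All.zip
    ( AllP.filter⁺ (λ t → T? (above t ≡ᵇ ℓ)) (AllP.applyUpTo⁺₁ (λ i → i) n (λ i<n → i<n))
    , All.map (λ {t} → ≡ᵇ⇒≡ (above t) ℓ) (AllP.all-filter (λ t → T? (above t ≡ᵇ ℓ)) (upTo n)))

  labelGroup-preserves : ∀ {m} s → 0 < m → Invariant m s → Invariant m (foldl (pairingStep n above) s (labelGroup m))
  labelGroup-preserves {m} s m>0 = go s (labelGroup m) (labelGroup-members m)
    where
    go : ∀ s ts → All (λ t → t < n × above t ≡ m) ts → Invariant m s → Invariant m (foldl (pairingStep n above) s ts)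
    go s []       []                         inv = inv
    go s (t ∷ ts) ((t<n , above-t) ∷ group) inv = go _ ts group (pairingStep-preserves s t<n above-t m>0 inv)

  weaken : ∀ {m s} → Invariant (suc m) s → Invariant m s
  weaken inv = record
    { free⇒unlabelled = free⇒unlabelled
    ; paired⇒labelled≥ = λ x below-x taken → map₂ <⇒≤ (paired⇒labelled≥ x below-x taken)
    ; leftNeighbour    = leftNeighbour
    }
    where open Invariant inv

  initial : ∀ m → Invariant m (below , λ _ → 0)
  initial m = record
    { free⇒unlabelled = λ _ _ → refl
    ; paired⇒labelled≥ = λ x below-x taken → contradiction (trans (sym below-x) taken) λ ()
    ; leftNeighbour    = λ _ ()
    }

  processGroups-preserves : ∀ m s → Invariant m s →
    Invariant 0 (foldl (pairingStep n above) s (concatMap labelGroup (map suc (downFrom m))))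
  processGroups-preserves zero    s inv = inv
  processGroups-preserves (suc m) s inv
    rewrite foldl-++ (pairingStep n above) s (labelGroup (suc m)) (concatMap labelGroup (map suc (downFrom m))) =
    processGroups-preserves m _ (weaken (labelGroup-preserves s (s≤s z≤n) inv))

pairStep-leftNeighbourDominates : ∀ n L above below → LeftNeighbourDominates n above below (pairStep n L above below)
pairStep-leftNeighbourDominates n L above below rewrite pairStep≡foldl-pairingStep n L above below =
  Invariant.leftNeighbour (processGroups-preserves L _ (initial L))
  where open PairingInvariant n above below

fill-leftNeighbour : ∀ {n above below label} ρ c → LeftNeighbourDominates n above below label →
  let f = fill ρ below label in
  ρ < f c → above c ≢ f c → f (cycPred n c) ≡ 0 ⊎ f c ≤ f (cycPred n c)
fill-leftNeighbour {n} {above} {below} {label} ρ c dominates ρ<f-c above≢f-c with below c in below-c | label c in label-c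
... | false | _     = contradiction ρ<f-c λ ()
... | true  | zero  = contradiction ρ<f-c (<-irrefl refl)
... | true  | suc ℓ with dominates c (subst (0 <_) (sym label-c) (s≤s z≤n)) (subst (above c ≢_) (sym label-c) above≢f-c)
...   | inj₁ left-empty rewrite left-empty = inj₁ refl
...   | inj₂ (left>0 , c≤left) with below (cycPred n c)
...     | false = inj₁ refl
...     | true with label (cycPred n c) | left>0 | subst (_≤ label (cycPred n c)) label-c c≤left
...       | suc _ | _ | c≤left′ = inj₂ c≤left′

rowLabels-leftNeighbour : ∀ n p (M : MLQ n p) k c →
  let f = rowLabels {n} {p} M (suc k) in
  largest p ∸ suc k < f c → rowLabels {n} {p} M k c ≢ f c → f (cycPred n c) ≡ 0 ⊎ f c ≤ f (cycPred n c)
rowLabels-leftNeighbour n p M k c =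
  fill-leftNeighbour {n} {above} {below} ρ c (pairStep-leftNeighbourDominates n (largest p) above below)
  where
  ρ : ℕ
  ρ = largest p ∸ suc k
  above : ℕ → ℕ
  above = rowLabels {n} {p} M k
  below : ℕ → Bool
  below = occ {n} {p} M ρ

rowLabels-top≤largest : ∀ n p (M : MLQ n p) c → rowLabels {n} {p} M 0 c ≤ largest p
rowLabels-top≤largest n p M c with occ {n} {p} M (largest p) c
... | true  = ≤-refl
... | false = z≤n

LM-row : ∀ n p M s j → 1 ≤ s → s ≤ largest p → LM n p M s j ≡ rowLabels {n} {p} M (largest p ∸ s) (cycPred n j)
LM-row n p M (suc s) j _ s≤L with suc s ≤ᵇ largest p | ≤⇒≤ᵇ s≤L
... | true | _ with j
...   | zero  = refl
...   | suc _ = refl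

LM-beyondTop : ∀ n p M s j → largest p < s → LM n p M s j ≡ 0
LM-beyondTop n p M (suc s) j L<s with suc s ≤ᵇ largest p in s≤ᵇL
... | false = refl
... | true  = contradiction (≤ᵇ⇒≤ (suc s) (largest p) (subst T (sym s≤ᵇL) _)) (<⇒≱ L<s)

m∸n≡suc[m∸suc[n]] : ∀ {m n} → n < m → m ∸ n ≡ suc (m ∸ suc n)
m∸n≡suc[m∸suc[n]] {suc m} {zero}  _         = refl
m∸n≡suc[m∸suc[n]] {suc m} {suc n} (s≤s n<m) = m∸n≡suc[m∸suc[n]] n<m

LM-inner : ∀ n p M s j → 1 ≤ s → s < largest p →
  LM n p M s j ≡ rowLabels {n} {p} M (suc (largest p ∸ suc s)) (cycPred n j)
LM-inner n p M s j 1≤s s<L =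
  trans (LM-row n p M s j 1≤s (<⇒≤ s<L)) (cong (λ k → rowLabels {n} {p} M k (cycPred n j)) (m∸n≡suc[m∸suc[n]] s<L))

LM-atOrAboveTop : ∀ n p M s j → largest p ≤ s → LM n p M s j ≤ s
LM-atOrAboveTop n p M zero    j _ = z≤n
LM-atOrAboveTop n p M (suc s) j L≤s with m≤n⇒m<n∨m≡n L≤s
... | inj₁ L<s rewrite LM-beyondTop n p M (suc s) j L<s = z≤n
... | inj₂ L≡s = begin
  LM n p M (suc s) j                                    ≡⟨ LM-row n p M (suc s) j (s≤s z≤n) (≤-reflexive (sym L≡s)) ⟩
  rowLabels {n} {p} M (largest p ∸ suc s) (cycPred n j) ≡⟨ cong (λ k → rowLabels {n} {p} M k (cycPred n j)) (m≤n⇒m∸n≡0 L≤s) ⟩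
  rowLabels {n} {p} M 0 (cycPred n j)                   ≤⟨ rowLabels-top≤largest n p M (cycPred n j) ⟩
  largest p                                             ≤⟨ L≤s ⟩
  suc s                                                 ∎
  where open ≤-Reasoning

lemma3p4 : (n : ℕ) (p : List ℕ) → IsPartition p → length p < n →
    (M : MLQ n p) → IsMLQ n p M →
    (r i : ℕ) → 1 ≤ i → i ≤ n →
    LM n p M r i > r → LM n p M (suc r) i ≢ LM n p M r i →
    (LM n p M r (i ∸ 1) ≡ 0) ⊎ (LM n p M r (i ∸ 1) ≥ LM n p M r i)
lemma3p4 n p _ _ M _ zero    (suc c) _ _ () _
lemma3p4 n p _ _ M _ (suc r) (suc c) _ _ gt ne with suc r <? largest p
... | no  r≮L = contradiction gt (≤⇒≯ (LM-atOrAboveTop n p M (suc r) (suc c) (≮⇒≥ r≮L)))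
... | yes r<L
  rewrite LM-inner n p M (suc r) (suc c) (s≤s z≤n) r<L
        | LM-inner n p M (suc r) c (s≤s z≤n) r<L
        | LM-row n p M (suc (suc r)) (suc c) (s≤s z≤n) r<L =
  rowLabels-leftNeighbour n p M k c (subst (_< rowLabels {n} {p} M (suc k) c) (sym ρ≡r) gt) ne
  where
  k : ℕ
  k = largest p ∸ suc (suc r)
  ρ≡r : largest p ∸ suc k ≡ suc r
  ρ≡r = trans (cong (largest p ∸_) (sym (m∸n≡suc[m∸suc[n]] r<L))) (m∸[m∸n]≡n (<⇒≤ r<L))
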